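{- Let $G_1$ and $G_2$ be simple connected graphs, neither of which contains a well-connected vertex. Then the disjunction $G_1\vee G_2$ satisfies \[ C^\xi(G_1\vee G_2) = |E(G_1)|\,|V(G_2)|^2 + |E(G_2)|\,|V(G_1)|^2 - 2|E(G_1)|\,|E(G_2)| . \]
   Context: A vertex of a graph is well-connected if it is adjacent to all other vertices of the graph. The disjunction $G_1\vee G_2$ has vertex set $V(G_1)\times V(G_2)$, with $(u_1,u_2)$ adjacent to $(v_1,v_2)$ whenever $u_1$ is adjacent to $v_1$ in $G_1$ or $u_2$ is adjacent to $v_2$ in $G_2$. For a connected graph $H$, $d_H(v)$ is the degree of $v$, the eccentricity $\varepsilon_H(v)$ is the largest distance from $v$ to any other vertex, and the connective eccentric index is $C^\xi(H)=\sum_{v\in V(H)} \frac{d_H(v)}{\varepsilon_H(v)}$. -}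

module Defs where

open import Data.Bool using (Bool; true; false; _∨_; _∧_; if_then_else_)
open import Data.Nat using (ℕ; zero; suc; _+_; _*_; _⊔_; _<ᵇ_)
open import Data.Fin using (Fin; zero; suc; toℕ; remQuot)
open import Data.Product using (Σ; ∃; _×_; _,_; proj₁; proj₂)
open import Data.Integer as ℤ using (ℤ; +_)
open import Data.Rational as ℚ using (ℚ; 0ℚ)
open import Relation.Binary.PropositionalEquality using (_≡_; _≢_; refl; cong₂)
open import Relation.Nullary using (¬_)

record SimpleGraph (n : ℕ) : Set where
  field
    adj    : Fin n → Fin n → Bool
    adj-sym : ∀ i j → adj i j ≡ adj j i
    irrefl : ∀ i → adj i i ≡ false
open SimpleGraph public

countF : ∀ {n} → (Fin n → Bool) → ℕ
countF {zero}  f = 0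
countF {suc n} f = (if f zero then 1 else 0) + countF (λ i → f (suc i))

sumF : ∀ {n} → (Fin n → ℕ) → ℕ
sumF {zero}  f = 0
sumF {suc n} f = f zero + sumF (λ i → f (suc i))

maxF : ∀ {n} → (Fin n → ℕ) → ℕ
maxF {zero}  f = 0
maxF {suc n} f = f zero ⊔ maxF (λ i → f (suc i))

sumℚ : ∀ {n} → (Fin n → ℚ) → ℚ
sumℚ {zero}  f = 0ℚ
sumℚ {suc n} f = f zero ℚ.+ sumℚ (λ i → f (suc i))

module _ {n : ℕ} (G : SimpleGraph n) where

  degree : Fin n → ℕ
  degree v = countF (λ u → adj G v u)

  edges : ℕ
  edges = sumF (λ i → countF (λ j → (toℕ i <ᵇ toℕ j) ∧ adj G i j))

  WellConnected : Fin n → Set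
  WellConnected v = ∀ u → u ≢ v → adj G v u ≡ true

  data Walk : Fin n → Fin n → ℕ → Set where
    nil  : ∀ {u} → Walk u u 0
    cons : ∀ {u w v k} → adj G u w ≡ true → Walk w v k → Walk u v (suc k)

  Connected : Set
  Connected = ∀ u v → ∃ λ k → Walk u v k

  anyF : ∀ {m} → (Fin m → Bool) → Bool
  anyF {zero}  f = false
  anyF {suc m} f = f zero ∨ anyF (λ i → f (suc i))

  eqF : ∀ {m} → Fin m → Fin m → Bool
  eqF zero    zero    = true
  eqF zero    (suc _) = false
  eqF (suc _) zero    = false
  eqF (suc i) (suc j) = eqF i j

  reach : ℕ → Fin n → Fin n → Bool
  reach zero    u v = eqF u v
  reach (suc k) u v = reach k u v ∨ anyF (λ w → reach k u w ∧ adj G w v)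

  -- least k < b with p k, and b if there is none
  firstTrue : (ℕ → Bool) → ℕ → ℕ
  firstTrue p zero    = zero
  firstTrue p (suc b) = if p 0 then 0 else suc (firstTrue (λ k → p (suc k)) b)

  -- distance = length of a shortest walk (for connected graphs it is < n)
  dist : Fin n → Fin n → ℕ
  dist u v = firstTrue (λ k → reach k u v) n

  ecc : Fin n → ℕ
  ecc v = maxF (λ u → dist v u)

  -- d(v) / ε(v) as a rational (ε(v) ≥ 1 whenever n ≥ 2; the value 0 is used
  -- for ε(v) = 0, which only occurs for the one-vertex graph)
  ratio : Fin n → ℚ
  ratio v with ecc v
  ... | zero  = 0ℚ
  ... | suc e = (+ degree v) ℚ./ suc e

  Cξ : ℚ
  Cξ = sumℚ ratio

-- disjunction G₁ ∨ G₂ on Fin (n₁ * n₂) ≅ Fin n₁ × Fin n₂ (via remQuot)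
fst : ∀ {n₁} n₂ → Fin (n₁ * n₂) → Fin n₁
fst {n₁} n₂ x = proj₁ (remQuot {n₁} n₂ x)

snd : ∀ {n₁} n₂ → Fin (n₁ * n₂) → Fin n₂
snd {n₁} n₂ x = proj₂ (remQuot {n₁} n₂ x)

disjAdj : ∀ {n₁ n₂} → SimpleGraph n₁ → SimpleGraph n₂ → Fin (n₁ * n₂) → Fin (n₁ * n₂) → Bool
disjAdj {n₁} {n₂} G₁ G₂ x y =
  adj G₁ (fst n₂ x) (fst n₂ y) ∨ adj G₂ (snd {n₁} n₂ x) (snd {n₁} n₂ y)

_⋁_ : ∀ {n₁ n₂} → SimpleGraph n₁ → SimpleGraph n₂ → SimpleGraph (n₁ * n₂)
_⋁_ {n₁} {n₂} G₁ G₂ = record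
  { adj     = disjAdj G₁ G₂
  ; adj-sym = λ x y → cong₂ _∨_ (adj-sym G₁ (fst n₂ x) (fst n₂ y)) (adj-sym G₂ (snd {n₁} n₂ x) (snd {n₁} n₂ y))
  ; irrefl  = λ x → cong₂ _∨_ (irrefl G₁ (fst n₂ x)) (irrefl G₂ (snd {n₁} n₂ x))
  }

toℚ : ℤ → ℚ
toℚ z = z ℚ./ 1

module Submission where

-- Every vertex of G₁ ∨ G₂ has eccentricity exactly 2, so C^ξ(G₁ ∨ G₂) is
-- half the degree sum, i.e. the number of edges of G₁ ∨ G₂; the theorem is
-- then an edge count.
--
--  * Finite sums and counting over Fin n, and the handshake lemma
--    (degree sum = 2·|E|).
--  * Degrees in the disjunction: by inclusion–exclusion on the grid
--    V(G₁) × V(G₂), deg(a,b) = n₂·d₁(a) + n₁·d₂(b) − d₁(a)·d₂(b); summing and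
--    applying the handshake lemma three times gives
--    |E(G₁ ∨ G₂)| + 2|E₁||E₂| = |E₁|n₂² + |E₂|n₁².
--  * Eccentricity: in any graph, a vertex that reaches every vertex through a
--    common neighbour and has a non-neighbour has eccentricity 2.  In G₁ ∨ G₂
--    both hold, since every vertex of a connected graph without well-connected
--    vertices has a neighbour and a non-neighbour.
--  * Rational arithmetic: if every eccentricity is 2 then C^ξ(G) = |E(G)|.

open import Defs
open import Data.Bool using (Bool; true; false; _∨_; _∧_; if_then_else_)
open import Data.Bool.Properties using (∨-zeroʳ)
import Data.Bool.Properties as Bool
open import Data.Nat using (ℕ; zero; suc; _+_; _*_; _^_; _≤_; _<_; z≤n; s≤s; _<ᵇ_)
open import Data.Nat.Properties
  using (+-assoc; +-identityʳ; +-commutativeSemigroup; *-zeroʳ; *-comm;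
         *-distribˡ-+; *-cancelˡ-≡; <-cmp; <⇒≤; ≤-refl; ≤-trans; ≤-antisym; m≤n+m;
         m+n∸n≡m; m≤m⊔n; m≤n⊔m; ⊔-lub)
open import Algebra.Properties.CommutativeSemigroup +-commutativeSemigroup using (interchange)
import Data.Nat.Tactic.RingSolver as ℕ-Solver
open import Data.Fin using (Fin; zero; suc; toℕ; combine; _↑ˡ_; _↑ʳ_)
open import Data.Fin.Properties using (remQuot-combine; toℕ-injective; ¬∀⟶∃¬)
import Data.Fin.Properties as Fin
open import Data.Integer as ℤ using (+_)
open import Data.Integer.Properties using (pos-*; [+m]-[+n]≡m⊖n; ⊖-≥)
import Data.Integer.Properties as ℤₚ
open import Data.Rational as ℚ using (ℚ)
open import Data.Rational.Properties using (toℚᵘ-injective; toℚᵘ-fromℚᵘ; toℚᵘ-homo-+; fromℚᵘ-cong)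
open import Data.Rational.Unnormalised as ℚᵘ using (mkℚᵘ; *≡*)
open import Data.Rational.Unnormalised.Properties using (≃-setoid; ≃-sym; +-cong)
import Data.Integer.Tactic.RingSolver as ℤ-Solver
open import Data.Product using (∃; _×_; _,_; proj₁; proj₂)
open import Data.Sum using (_⊎_; inj₁; inj₂)
open import Data.Empty using (⊥-elim)
open import Function using (case_of_)
open import Relation.Nullary using (¬_; yes; no; Dec)
open import Relation.Binary using (tri<; tri≈; tri>)
open import Relation.Binary.PropositionalEquality
import Relation.Binary.Reasoning.Setoid as SetoidReasoning

indicator : Bool → ℕ
indicator true  = 1
indicator false = 0

countF-as-sumF : ∀ {n} (f : Fin n → Bool) → countF f ≡ sumF (λ i → indicator (f i))
countF-as-sumF {zero}  f = refl
countF-as-sumF {suc n} f = cong₂ _+_ (if-indicator (f zero)) (countF-as-sumF (λ i → f (suc i)))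
  where
  if-indicator : ∀ b → (if b then 1 else 0) ≡ indicator b
  if-indicator true  = refl
  if-indicator false = refl

sumF-cong : ∀ {n} {f g : Fin n → ℕ} → (∀ i → f i ≡ g i) → sumF f ≡ sumF g
sumF-cong {zero}  f≗g = refl
sumF-cong {suc n} f≗g = cong₂ _+_ (f≗g zero) (sumF-cong (λ i → f≗g (suc i)))

sumF-+ : ∀ {n} (f g : Fin n → ℕ) → sumF (λ i → f i + g i) ≡ sumF f + sumF g
sumF-+ {zero}  f g = refl
sumF-+ {suc n} f g =
  trans (cong (_+_ (f zero + g zero)) (sumF-+ (λ i → f (suc i)) (λ i → g (suc i))))
        (interchange (f zero) (g zero) _ _)

sumF-*ˡ : ∀ {n} c (f : Fin n → ℕ) → sumF (λ i → c * f i) ≡ c * sumF f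
sumF-*ˡ {zero}  c f = sym (*-zeroʳ c)
sumF-*ˡ {suc n} c f =
  trans (cong (_+_ (c * f zero)) (sumF-*ˡ c (λ i → f (suc i)))) (sym (*-distribˡ-+ c (f zero) _))

sumF-const : ∀ {n} c → sumF {n} (λ _ → c) ≡ n * c
sumF-const {zero}  c = refl
sumF-const {suc n} c = cong (_+_ c) (sumF-const {n} c)

sumF-swap : ∀ {m n} (f : Fin m → Fin n → ℕ) →
  sumF (λ i → sumF (λ j → f i j)) ≡ sumF (λ j → sumF (λ i → f i j))
sumF-swap {zero}  {n} f = sym (trans (sumF-const {n} 0) (*-zeroʳ n))
sumF-swap {suc m} {n} f =
  trans (cong (_+_ (sumF (f zero))) (sumF-swap (λ i → f (suc i))))
        (sym (sumF-+ (f zero) (λ j → sumF (λ i → f (suc i) j))))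

sumF²-+ : ∀ {m n} (f g : Fin m → Fin n → ℕ) →
  sumF (λ i → sumF (λ j → f i j + g i j))
    ≡ sumF (λ i → sumF (λ j → f i j)) + sumF (λ i → sumF (λ j → g i j))
sumF²-+ f g = trans (sumF-cong (λ i → sumF-+ (f i) (g i))) (sumF-+ (λ i → sumF (f i)) (λ i → sumF (g i)))

sumF-product : ∀ {m n} (f : Fin m → ℕ) (g : Fin n → ℕ) →
  sumF (λ i → sumF (λ j → f i * g j)) ≡ sumF f * sumF g
sumF-product f g =
  trans (sumF-cong (λ i → sumF-*ˡ (f i) g))
        (trans (sumF-cong (λ i → *-comm (f i) (sumF g)))
               (trans (sumF-*ˡ (sumF g) f) (*-comm (sumF g) (sumF f))))

sumF-row : ∀ {m n} (f : Fin m → ℕ) → sumF (λ i → sumF {n} (λ _ → f i)) ≡ n * sumF f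
sumF-row {n = n} f = trans (sumF-cong (λ i → sumF-const {n} (f i))) (sumF-*ˡ n f)

sumF-column : ∀ {m n} (g : Fin n → ℕ) → sumF {m} (λ _ → sumF (λ j → g j)) ≡ m * sumF g
sumF-column {m} g = sumF-const {m} (sumF g)

sumF-↑ : ∀ a b (g : Fin (a + b) → ℕ) →
  sumF g ≡ sumF (λ i → g (i ↑ˡ b)) + sumF (λ j → g (a ↑ʳ j))
sumF-↑ zero    b g = refl
sumF-↑ (suc a) b g =
  trans (cong (_+_ (g zero)) (sumF-↑ a b (λ i → g (suc i)))) (sym (+-assoc (g zero) _ _))

sumF-combine : ∀ m n (g : Fin (m * n) → ℕ) →
  sumF g ≡ sumF (λ i → sumF (λ j → g (combine {m} {n} i j)))
sumF-combine zero    n g = refl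
sumF-combine (suc m) n g =
  trans (sumF-↑ n (m * n) g) (cong (_+_ (sumF (λ j → g (j ↑ˡ (m * n))))) (sumF-combine m n (λ x → g (n ↑ʳ x))))

sumF-pairs : ∀ n₁ n₂ (h : Fin n₁ → Fin n₂ → ℕ) →
  sumF {n₁ * n₂} (λ x → h (fst n₂ x) (snd {n₁} n₂ x)) ≡ sumF (λ i → sumF (λ j → h i j))
sumF-pairs n₁ n₂ h =
  trans (sumF-combine n₁ n₂ _)
        (sumF-cong (λ i → sumF-cong (λ j →
          cong (λ p → h (proj₁ p) (proj₂ p)) (remQuot-combine {n₁} {n₂} i j))))

<ᵇ-true : ∀ m n → m < n → (m <ᵇ n) ≡ true
<ᵇ-true zero    (suc n) _         = refl
<ᵇ-true (suc m) (suc n) (s≤s m<n) = <ᵇ-true m n m<n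

<ᵇ-false : ∀ m n → n ≤ m → (m <ᵇ n) ≡ false
<ᵇ-false m       zero    _         = refl
<ᵇ-false (suc m) (suc n) (s≤s n≤m) = <ᵇ-false m n n≤m

module _ {n : ℕ} (G : SimpleGraph n) where

  upperEdge : Fin n → Fin n → ℕ
  upperEdge i j = indicator ((toℕ i <ᵇ toℕ j) ∧ adj G i j)

  adj-triangles : ∀ i j → indicator (adj G i j) ≡ upperEdge i j + upperEdge j i
  adj-triangles i j with <-cmp (toℕ i) (toℕ j)
  ... | tri< i<j _ _ rewrite <ᵇ-true _ _ i<j | <ᵇ-false _ _ (<⇒≤ i<j) = sym (+-identityʳ _)
  ... | tri> _ _ j<i rewrite <ᵇ-true _ _ j<i | <ᵇ-false _ _ (<⇒≤ j<i) | adj-sym G i j = refl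
  ... | tri≈ _ i≡j _ with toℕ-injective {i = i} {j = j} i≡j
  ... | refl rewrite <ᵇ-false (toℕ i) (toℕ i) ≤-refl | irrefl G i = refl

  handshake : sumF (degree G) ≡ 2 * edges G
  handshake = begin
    sumF (degree G)
      ≡⟨ sumF-cong (λ i → countF-as-sumF (adj G i)) ⟩
    sumF (λ i → sumF (λ j → indicator (adj G i j)))
      ≡⟨ sumF-cong (λ i → sumF-cong (adj-triangles i)) ⟩
    sumF (λ i → sumF (λ j → upperEdge i j + upperEdge j i))
      ≡⟨ sumF²-+ upperEdge (λ i j → upperEdge j i) ⟩
    E + sumF (λ i → sumF (λ j → upperEdge j i))
      ≡⟨ cong (_+_ E) (sumF-swap (λ i j → upperEdge j i)) ⟩
    E + E
      ≡⟨ cong (λ e → e + e) (sym edges≡E) ⟩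
    edges G + edges G
      ≡⟨ cong (_+_ (edges G)) (sym (+-identityʳ (edges G))) ⟩
    2 * edges G ∎
    where
    open ≡-Reasoning
    E : ℕ
    E = sumF (λ i → sumF (λ j → upperEdge i j))
    edges≡E : edges G ≡ E
    edges≡E = sumF-cong (λ i → countF-as-sumF (λ j → (toℕ i <ᵇ toℕ j) ∧ adj G i j))

indicator-∨ : ∀ a b → indicator (a ∨ b) + indicator a * indicator b ≡ indicator a + indicator b
indicator-∨ true  true  = refl
indicator-∨ true  false = refl
indicator-∨ false true  = refl
indicator-∨ false false = refl

count-∨-grid : ∀ {n₁ n₂} (A : Fin n₁ → Bool) (B : Fin n₂ → Bool) →
  sumF (λ i → sumF (λ j → indicator (A i ∨ B j))) + countF A * countF B
    ≡ n₂ * countF A + n₁ * countF B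
count-∨-grid {n₁} {n₂} A B = begin
  sumF (λ i → sumF (λ j → indicator (A i ∨ B j))) + countF A * countF B
    ≡⟨ cong (_+_ (sumF (λ i → sumF (λ j → indicator (A i ∨ B j)))))
            (trans (cong₂ _*_ (countF-as-sumF A) (countF-as-sumF B)) (sym (sumF-product a b))) ⟩
  sumF (λ i → sumF (λ j → indicator (A i ∨ B j))) + sumF (λ i → sumF (λ j → a i * b j))
    ≡⟨ sym (sumF²-+ (λ i j → indicator (A i ∨ B j)) (λ i j → a i * b j)) ⟩
  sumF (λ i → sumF (λ j → indicator (A i ∨ B j) + a i * b j))
    ≡⟨ sumF-cong (λ i → sumF-cong (λ j → indicator-∨ (A i) (B j))) ⟩
  sumF (λ i → sumF (λ j → a i + b j))
    ≡⟨ sumF²-+ (λ i _ → a i) (λ _ j → b j) ⟩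
  sumF (λ i → sumF {n₂} (λ _ → a i)) + sumF {n₁} (λ _ → sumF b)
    ≡⟨ cong₂ _+_ (sumF-row {n = n₂} a) (sumF-column {n₁} b) ⟩
  n₂ * sumF a + n₁ * sumF b
    ≡⟨ sym (cong₂ (λ p q → n₂ * p + n₁ * q) (countF-as-sumF A) (countF-as-sumF B)) ⟩
  n₂ * countF A + n₁ * countF B ∎
  where
  open ≡-Reasoning
  a : Fin n₁ → ℕ
  a i = indicator (A i)
  b : Fin n₂ → ℕ
  b j = indicator (B j)

module _ {n₁ n₂ : ℕ} (G₁ : SimpleGraph n₁) (G₂ : SimpleGraph n₂) where

  private
    d₁ : Fin n₁ → ℕ
    d₁ = degree G₁
    d₂ : Fin n₂ → ℕ
    d₂ = degree G₂
    m₁ m₂ : ℕ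
    m₁ = edges G₁
    m₂ = edges G₂

  degree-⋁ : ∀ x → degree (G₁ ⋁ G₂) x + d₁ (fst n₂ x) * d₂ (snd {n₁} n₂ x)
                    ≡ n₂ * d₁ (fst n₂ x) + n₁ * d₂ (snd {n₁} n₂ x)
  degree-⋁ x =
    trans (cong (λ k → k + d₁ a * d₂ b)
                (trans (countF-as-sumF {n₁ * n₂} _)
                       (sumF-pairs n₁ n₂ (λ i j → indicator (adj G₁ a i ∨ adj G₂ b j)))))
          (count-∨-grid (adj G₁ a) (adj G₂ b))
    where
    a = fst n₂ x
    b = snd {n₁} n₂ x

  degree-sum-⋁ : sumF (degree (G₁ ⋁ G₂)) + sumF d₁ * sumF d₂
                  ≡ n₂ * (n₂ * sumF d₁) + n₁ * (n₁ * sumF d₂)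
  degree-sum-⋁ = begin
    sumF (degree (G₁ ⋁ G₂)) + sumF d₁ * sumF d₂
      ≡⟨ cong (_+_ (sumF (degree (G₁ ⋁ G₂))))
              (sym (trans (sumF-pairs n₁ n₂ (λ i j → d₁ i * d₂ j)) (sumF-product d₁ d₂))) ⟩
    sumF (degree (G₁ ⋁ G₂)) + sumF (λ x → d₁ (fst n₂ x) * d₂ (snd {n₁} n₂ x))
      ≡⟨ sym (sumF-+ (degree (G₁ ⋁ G₂)) (λ x → d₁ (fst n₂ x) * d₂ (snd {n₁} n₂ x))) ⟩
    sumF (λ x → degree (G₁ ⋁ G₂) x + d₁ (fst n₂ x) * d₂ (snd {n₁} n₂ x))
      ≡⟨ sumF-cong degree-⋁ ⟩
    sumF (λ x → n₂ * d₁ (fst n₂ x) + n₁ * d₂ (snd {n₁} n₂ x))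
      ≡⟨ sumF-pairs n₁ n₂ (λ i j → n₂ * d₁ i + n₁ * d₂ j) ⟩
    sumF (λ i → sumF (λ j → n₂ * d₁ i + n₁ * d₂ j))
      ≡⟨ sumF²-+ (λ i _ → n₂ * d₁ i) (λ _ j → n₁ * d₂ j) ⟩
    sumF (λ i → sumF {n₂} (λ _ → n₂ * d₁ i)) + sumF {n₁} (λ _ → sumF (λ j → n₁ * d₂ j))
      ≡⟨ cong₂ _+_ (sumF-row {n = n₂} (λ i → n₂ * d₁ i)) (sumF-column {n₁} (λ j → n₁ * d₂ j)) ⟩
    n₂ * sumF (λ i → n₂ * d₁ i) + n₁ * sumF (λ j → n₁ * d₂ j)
      ≡⟨ cong₂ (λ p q → n₂ * p + n₁ * q) (sumF-*ˡ n₂ d₁) (sumF-*ˡ n₁ d₂) ⟩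
    n₂ * (n₂ * sumF d₁) + n₁ * (n₁ * sumF d₂) ∎
    where open ≡-Reasoning

  -- The edge count of the disjunction, with the subtracted term moved left.
  edges-⋁ : edges (G₁ ⋁ G₂) + 2 * m₁ * m₂ ≡ m₁ * n₂ ^ 2 + m₂ * n₁ ^ 2
  edges-⋁ = *-cancelˡ-≡ _ _ 2 (begin
    2 * (edges (G₁ ⋁ G₂) + 2 * m₁ * m₂)
      ≡⟨ distribute (edges (G₁ ⋁ G₂)) m₁ m₂ ⟩
    2 * edges (G₁ ⋁ G₂) + 2 * m₁ * (2 * m₂)
      ≡⟨ sym (cong₂ (λ p q → p + q) (handshake (G₁ ⋁ G₂)) (cong₂ _*_ (handshake G₁) (handshake G₂))) ⟩
    sumF (degree (G₁ ⋁ G₂)) + sumF d₁ * sumF d₂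
      ≡⟨ degree-sum-⋁ ⟩
    n₂ * (n₂ * sumF d₁) + n₁ * (n₁ * sumF d₂)
      ≡⟨ cong₂ (λ p q → n₂ * (n₂ * p) + n₁ * (n₁ * q)) (handshake G₁) (handshake G₂) ⟩
    n₂ * (n₂ * (2 * m₁)) + n₁ * (n₁ * (2 * m₂))
      ≡⟨ collect m₁ m₂ n₁ n₂ ⟩
    2 * (m₁ * n₂ ^ 2 + m₂ * n₁ ^ 2) ∎)
    where
    open ≡-Reasoning
    distribute : ∀ e x y → 2 * (e + 2 * x * y) ≡ 2 * e + 2 * x * (2 * y)
    distribute = ℕ-Solver.solve-∀
    -- b ^ 2 unfolds to b * (b * 1), the form in which the solver accepts it
    collect : ∀ x y a b → b * (b * (2 * x)) + a * (a * (2 * y)) ≡ 2 * (x * (b * (b * 1)) + y * (a * (a * 1)))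
    collect = ℕ-Solver.solve-∀

maxF-lub : ∀ {n} (f : Fin n → ℕ) c → (∀ i → f i ≤ c) → maxF f ≤ c
maxF-lub {zero}  f c f≤c = z≤n
maxF-lub {suc n} f c f≤c = ⊔-lub (f≤c zero) (maxF-lub (λ i → f (suc i)) c (λ i → f≤c (suc i)))

maxF-upper : ∀ {n} (f : Fin n → ℕ) i → f i ≤ maxF f
maxF-upper f zero    = m≤m⊔n _ _
maxF-upper f (suc i) = ≤-trans (maxF-upper (λ i → f (suc i)) i) (m≤n⊔m (f zero) _)

distinct⇒2≤ : ∀ {m} (x y : Fin m) → x ≢ y → 2 ≤ m
distinct⇒2≤ {suc zero}    zero zero x≢y = ⊥-elim (x≢y refl)
distinct⇒2≤ {suc (suc m)} x    y    x≢y = s≤s (s≤s z≤n)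

∨-true : ∀ {a b} → a ∨ b ≡ true → a ≡ true ⊎ b ≡ true
∨-true {true}  _   = inj₁ refl
∨-true {false} b≡t = inj₂ b≡t

∧-true : ∀ {a b} → a ∧ b ≡ true → a ≡ true × b ≡ true
∧-true {true} {true} _ = refl , refl

module _ {n : ℕ} (G : SimpleGraph n) where

  eqF-refl : ∀ {m} (x : Fin m) → eqF G x x ≡ true
  eqF-refl zero    = refl
  eqF-refl (suc x) = eqF-refl x

  eqF-sound : ∀ {m} (x y : Fin m) → eqF G x y ≡ true → x ≡ y
  eqF-sound zero    zero    _ = refl
  eqF-sound (suc x) (suc y) e = cong suc (eqF-sound x y e)

  anyF-intro : ∀ {m} (f : Fin m → Bool) w → f w ≡ true → anyF G f ≡ true
  anyF-intro f zero    fw rewrite fw = refl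
  anyF-intro f (suc w) fw =
    trans (cong (f zero ∨_) (anyF-intro (λ i → f (suc i)) w fw)) (∨-zeroʳ (f zero))

  anyF-elim : ∀ {m} (f : Fin m → Bool) → anyF G f ≡ true → ∃ λ w → f w ≡ true
  anyF-elim {suc m} f any with ∨-true {f zero} any
  ... | inj₁ f0 = zero , f0
  ... | inj₂ rest with anyF-elim (λ i → f (suc i)) rest
  ... | w , fw = suc w , fw

  reach-1 : ∀ x y → reach G 1 x y ≡ true → x ≡ y ⊎ adj G x y ≡ true
  reach-1 x y r with ∨-true {eqF G x y} r
  ... | inj₁ x≡y = inj₁ (eqF-sound x y x≡y)
  ... | inj₂ step with anyF-elim (λ w → eqF G x w ∧ adj G w y) step
  ... | w , xwy with ∧-true {eqF G x w} xwy
  ... | x≡w , wy with eqF-sound x w x≡w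
  ... | refl = inj₂ wy

  reach-adj : ∀ x y → adj G x y ≡ true → reach G 1 x y ≡ true
  reach-adj x y xy =
    trans (cong (eqF G x y ∨_) (anyF-intro (λ w → eqF G x w ∧ adj G w y) x
                                          (trans (cong (_∧ adj G x y) (eqF-refl x)) xy)))
          (∨-zeroʳ _)

  reach-common : ∀ x w y → adj G x w ≡ true → adj G w y ≡ true → reach G 2 x y ≡ true
  reach-common x w y xw wy =
    trans (cong (reach G 1 x y ∨_) (anyF-intro (λ v → reach G 1 x v ∧ adj G v y) w
                                              (cong₂ _∧_ (reach-adj x w xw) wy)))
          (∨-zeroʳ _)

  firstTrue-≤ : ∀ (p : ℕ → Bool) b k → p k ≡ true → firstTrue G p b ≤ k
  firstTrue-≤ p zero    k       pk = z≤n
  firstTrue-≤ p (suc b) k       pk with p 0 in p0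
  ... | true = z≤n
  firstTrue-≤ p (suc b) zero    pk | false with trans (sym p0) pk
  ... | ()
  firstTrue-≤ p (suc b) (suc k) pk | false = s≤s (firstTrue-≤ (λ i → p (suc i)) b k pk)

  firstTrue-≥2 : ∀ (p : ℕ → Bool) {b} → 2 ≤ b → p 0 ≡ false → p 1 ≡ false → 2 ≤ firstTrue G p b
  firstTrue-≥2 p (s≤s (s≤s _)) p0 p1 rewrite p0 | p1 = s≤s (s≤s z≤n)

  dist-≤2 : ∀ x w y → adj G x w ≡ true → adj G w y ≡ true → dist G x y ≤ 2
  dist-≤2 x w y xw wy = firstTrue-≤ (λ k → reach G k x y) n 2 (reach-common x w y xw wy)

  dist-≥2 : ∀ x y → x ≢ y → adj G x y ≡ false → 2 ≤ dist G x y
  dist-≥2 x y x≢y ¬xy = firstTrue-≥2 (λ k → reach G k x y) (distinct⇒2≤ x y x≢y) not-0 not-1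
    where
    not-0 : reach G 0 x y ≡ false
    not-0 = Bool.¬-not (λ r → x≢y (eqF-sound x y r))
    not-1 : reach G 1 x y ≡ false
    not-1 = Bool.¬-not λ r → case reach-1 x y r of λ where
      (inj₁ x≡y) → x≢y x≡y
      (inj₂ xy)  → Bool.not-¬ ¬xy xy

  ecc≡2 : ∀ x → (∀ y → ∃ λ w → adj G x w ≡ true × adj G w y ≡ true)
              → (∃ λ y → y ≢ x × adj G x y ≡ false)
              → ecc G x ≡ 2
  ecc≡2 x common (y , y≢x , ¬xy) =
    ≤-antisym (maxF-lub (dist G x) 2 (λ z → let (w , xw , wz) = common z in dist-≤2 x w z xw wz))
              (≤-trans (dist-≥2 x y (λ x≡y → y≢x (sym x≡y)) ¬xy) (maxF-upper (dist G x) y))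

module _ {n : ℕ} (G : SimpleGraph n) where

  non-neighbour : ∀ v → ¬ WellConnected G v → ∃ λ u → u ≢ v × adj G v u ≡ false
  non-neighbour v ¬wc with ¬∀⟶∃¬ n (λ u → u ≢ v → adj G v u ≡ true) decide ¬wc
    where
    decide : ∀ u → Dec (u ≢ v → adj G v u ≡ true)
    decide u with u Fin.≟ v | adj G v u Bool.≟ true
    ... | yes u≡v | _        = yes (λ u≢v → ⊥-elim (u≢v u≡v))
    ... | no  _   | yes vu   = yes (λ _ → vu)
    ... | no  u≢v | no  ¬vu  = no (λ f → ¬vu (f u≢v))
  ... | u , ¬P = u , (λ u≡v → ¬P (λ u≢v → ⊥-elim (u≢v u≡v))) , Bool.¬-not (λ vu → ¬P (λ _ → vu))

  -- In a connected graph, a vertex that is not well-connected has a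
  -- neighbour: the first step of a walk to one of its non-neighbours.
  neighbour : Connected G → ∀ v → ¬ WellConnected G v → ∃ λ u → adj G v u ≡ true
  neighbour connected v ¬wc with non-neighbour v ¬wc
  ... | u , u≢v , _ with connected v u
  ... | zero  , nil               = ⊥-elim (u≢v refl)
  ... | suc k , cons {w = w} vw _ = w , vw

module _ {n₁ n₂ : ℕ} (G₁ : SimpleGraph n₁) (G₂ : SimpleGraph n₂)
         (connected₁ : Connected G₁) (connected₂ : Connected G₂)
         (¬wc₁ : ∀ v → ¬ WellConnected G₁ v) (¬wc₂ : ∀ v → ¬ WellConnected G₂ v) where

  private
    fst-combine : ∀ a b → fst {n₁} n₂ (combine a b) ≡ a
    fst-combine a b = cong proj₁ (remQuot-combine {n₁} {n₂} a b)
    snd-combine : ∀ a b → snd {n₁} n₂ (combine a b) ≡ b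
    snd-combine a b = cong proj₂ (remQuot-combine {n₁} {n₂} a b)

  -- x = (a , b) and y = (c , d) have the common neighbour (a′ , d′), where
  -- a′ ~ a in G₁ and d′ ~ d in G₂.
  common-neighbour-⋁ : ∀ x y → ∃ λ w → adj (G₁ ⋁ G₂) x w ≡ true × adj (G₁ ⋁ G₂) w y ≡ true
  common-neighbour-⋁ x y = w , x~w , w~y
    where
    a = fst n₂ x
    d = snd {n₁} n₂ y
    a′ = proj₁ (neighbour G₁ connected₁ a (¬wc₁ a))
    d′ = proj₁ (neighbour G₂ connected₂ d (¬wc₂ d))
    w = combine {n₁} {n₂} a′ d′
    x~w : adj (G₁ ⋁ G₂) x w ≡ true
    x~w = cong (_∨ adj G₂ (snd {n₁} n₂ x) (snd {n₁} n₂ w))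
               (trans (cong (adj G₁ a) (fst-combine a′ d′)) (proj₂ (neighbour G₁ connected₁ a (¬wc₁ a))))
    w~y : adj (G₁ ⋁ G₂) w y ≡ true
    w~y = trans (cong (adj G₁ (fst n₂ w) (fst n₂ y) ∨_)
                      (trans (cong (λ z → adj G₂ z d) (snd-combine a′ d′))
                             (trans (adj-sym G₂ d′ d) (proj₂ (neighbour G₂ connected₂ d (¬wc₂ d))))))
                (∨-zeroʳ _)

  -- (a , b) is not adjacent to (a′ , b′) when a′ ≁ a and b′ ≁ b.
  non-neighbour-⋁ : ∀ x → ∃ λ y → y ≢ x × adj (G₁ ⋁ G₂) x y ≡ false
  non-neighbour-⋁ x = y , y≢x , x≁y
    where
    a = fst n₂ x
    b = snd {n₁} n₂ x
    far₁ = non-neighbour G₁ a (¬wc₁ a)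
    far₂ = non-neighbour G₂ b (¬wc₂ b)
    y = combine {n₁} {n₂} (proj₁ far₁) (proj₁ far₂)
    y≢x : y ≢ x
    y≢x y≡x = proj₁ (proj₂ far₁) (trans (sym (fst-combine _ _)) (cong (fst n₂) y≡x))
    x≁y : adj (G₁ ⋁ G₂) x y ≡ false
    x≁y = cong₂ _∨_ (trans (cong (adj G₁ a) (fst-combine _ _)) (proj₂ (proj₂ far₁)))
                    (trans (cong (adj G₂ b) (snd-combine _ _)) (proj₂ (proj₂ far₂)))

  ecc-⋁ : ∀ x → ecc (G₁ ⋁ G₂) x ≡ 2
  ecc-⋁ x = ecc≡2 (G₁ ⋁ G₂) x (common-neighbour-⋁ x) (non-neighbour-⋁ x)

half : ℕ → ℚ
half k = + k ℚ./ 2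

half-+ : ∀ a b → half a ℚ.+ half b ≡ half (a + b)
half-+ a b = toℚᵘ-injective (begin
    ℚ.toℚᵘ (ℚ.fromℚᵘ ua ℚ.+ ℚ.fromℚᵘ ub)          ≈⟨ toℚᵘ-homo-+ (ℚ.fromℚᵘ ua) (ℚ.fromℚᵘ ub) ⟩
    ℚ.toℚᵘ (ℚ.fromℚᵘ ua) ℚᵘ.+ ℚ.toℚᵘ (ℚ.fromℚᵘ ub) ≈⟨ +-cong (toℚᵘ-fromℚᵘ ua) (toℚᵘ-fromℚᵘ ub) ⟩
    ua ℚᵘ.+ ub                                      ≈⟨ *≡* (cross-multiply (+ a) (+ b)) ⟩
    uc                                              ≈⟨ ≃-sym (toℚᵘ-fromℚᵘ uc) ⟩
    ℚ.toℚᵘ (ℚ.fromℚᵘ uc)                            ∎)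
  where
  open SetoidReasoning ≃-setoid
  ua = mkℚᵘ (+ a) 1
  ub = mkℚᵘ (+ b) 1
  uc = mkℚᵘ (+ (a + b)) 1
  cross-multiply : ∀ x y → (x ℤ.* + 2 ℤ.+ y ℤ.* + 2) ℤ.* + 2 ≡ (x ℤ.+ y) ℤ.* (+ 2 ℤ.* + 2)
  cross-multiply = ℤ-Solver.solve-∀

sumℚ-half : ∀ {n} (f : Fin n → ℕ) → sumℚ (λ i → half (f i)) ≡ half (sumF f)
sumℚ-half {zero}  f = refl
sumℚ-half {suc n} f =
  trans (cong (half (f zero) ℚ.+_) (sumℚ-half (λ i → f (suc i)))) (half-+ (f zero) _)

half-double : ∀ k → half (2 * k) ≡ toℚ (+ k)
half-double k = fromℚᵘ-cong {mkℚᵘ (+ (2 * k)) 1} {mkℚᵘ (+ k) 0} (*≡* cross-multiply)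
  where
  cross-multiply : + (2 * k) ℤ.* + 1 ≡ + k ℤ.* + 2
  cross-multiply = trans (ℤₚ.*-identityʳ (+ (2 * k))) (trans (cong +_ (*-comm 2 k)) (pos-* k 2))

sumℚ-cong : ∀ {n} {f g : Fin n → ℚ} → (∀ i → f i ≡ g i) → sumℚ f ≡ sumℚ g
sumℚ-cong {zero}  f≗g = refl
sumℚ-cong {suc n} f≗g = cong₂ ℚ._+_ (f≗g zero) (sumℚ-cong (λ i → f≗g (suc i)))

ratio-ecc2 : ∀ {n} (G : SimpleGraph n) v → ecc G v ≡ 2 → ratio G v ≡ half (degree G v)
ratio-ecc2 G v ε≡2 with ecc G v
ratio-ecc2 G v refl | .2 = refl

Cξ-ecc2 : ∀ {n} (G : SimpleGraph n) → (∀ v → ecc G v ≡ 2) → Cξ G ≡ toℚ (+ edges G)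
Cξ-ecc2 G ε≡2 = begin
  Cξ G                           ≡⟨ sumℚ-cong (λ v → ratio-ecc2 G v (ε≡2 v)) ⟩
  sumℚ (λ v → half (degree G v)) ≡⟨ sumℚ-half (degree G) ⟩
  half (sumF (degree G))         ≡⟨ cong half (handshake G) ⟩
  half (2 * edges G)             ≡⟨ half-double (edges G) ⟩
  toℚ (+ edges G)                ∎
  where open ≡-Reasoning

pos-minus : ∀ a b {c} → a + b ≡ c → + a ≡ + c ℤ.- + b
pos-minus a b refl =
  sym (trans ([+m]-[+n]≡m⊖n (a + b) b) (trans (⊖-≥ (m≤n+m b a)) (cong +_ (m+n∸n≡m a b))))

theorem6 : ∀ {n₁ n₂ : ℕ} (G₁ : SimpleGraph n₁) (G₂ : SimpleGraph n₂)
    → Connected G₁ → Connected G₂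
    → (∀ v → ¬ WellConnected G₁ v) → (∀ v → ¬ WellConnected G₂ v)
    → Cξ (G₁ ⋁ G₂)
      ≡ toℚ ((+ (edges G₁ * n₂ ^ 2 + edges G₂ * n₁ ^ 2)) ℤ.- (+ (2 * edges G₁ * edges G₂)))
theorem6 {n₁} {n₂} G₁ G₂ connected₁ connected₂ ¬wc₁ ¬wc₂ = begin
  Cξ (G₁ ⋁ G₂)
    ≡⟨ Cξ-ecc2 (G₁ ⋁ G₂) (ecc-⋁ G₁ G₂ connected₁ connected₂ ¬wc₁ ¬wc₂) ⟩
  toℚ (+ edges (G₁ ⋁ G₂))
    ≡⟨ cong toℚ (pos-minus (edges (G₁ ⋁ G₂)) (2 * edges G₁ * edges G₂) (edges-⋁ G₁ G₂)) ⟩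
  toℚ ((+ (edges G₁ * n₂ ^ 2 + edges G₂ * n₁ ^ 2)) ℤ.- (+ (2 * edges G₁ * edges G₂))) ∎
  where open ≡-Reasoning
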